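{- For every $n\geq 3$, the prism graph $\Pi_n$ is equitably 3-choosable.
   Context: The prism graph $\Pi_n$ ($n\ge 3$) is the Cartesian product $C_n \square K_2$: it has vertices $u_1,\dots,u_n,v_1,\dots,v_n$ and edges $u_iu_{i+1}$, $v_iv_{i+1}$ (indices mod $n$) and $u_iv_i$ for $1\le i\le n$. A list assignment $L$ assigns to each vertex $v$ a set $L(v)$ of colors; it is $k$-uniform if $|L(v)|=k$ for all $v$. A proper $L$-coloring is a proper vertex coloring $c$ with $c(v)\in L(v)$ for all $v$. A graph $G$ is equitably $k$-choosable if for every $k$-uniform list assignment $L$ of $G$ there is a proper $L$-coloring in which each color is used on at most $\lceil |V(G)|/k\rceil$ vertices. -}

module Defs where

open import Data.Nat using (ℕ; zero; suc; _+_; _*_; _≤_; _≥_; NonZero)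
open import Data.Nat.DivMod using (_/_; _%_)
open import Data.Nat.Properties using (_≟_)
open import Data.Fin using (Fin; toℕ)
open import Data.Bool using (Bool; true; false)
open import Data.Product using (_×_; _,_; proj₁; proj₂)
open import Data.Sum using (_⊎_)
open import Data.List using (List; length; filter; allFin; cartesianProduct; _∷_; [])
open import Data.List.Membership.Propositional using (_∈_)
open import Data.List.Relation.Unary.Unique.Propositional using (Unique)
open import Relation.Binary.PropositionalEquality using (_≡_; _≢_)
open import Relation.Nullary using (¬_)

Color : Set
Color = ℕ

-- Vertices of the prism Π_n: (i , false) is u_{i+1}, (i , true) is v_{i+1}.
PVertex : ℕ → Set
PVertex n = Fin n × Bool

CycSucc : (n : ℕ) → Fin n → Fin n → Set
CycSucc n i j = (toℕ j ≡ suc (toℕ i)) ⊎ ((suc (toℕ i) ≡ n) × (toℕ j ≡ 0))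

CycAdj : (n : ℕ) → Fin n → Fin n → Set
CycAdj n i j = CycSucc n i j ⊎ CycSucc n j i

PrismAdj : (n : ℕ) → PVertex n → PVertex n → Set
PrismAdj n (i , a) (j , b) = ((a ≡ b) × CycAdj n i j) ⊎ ((i ≡ j) × (a ≢ b))

prismVertices : (n : ℕ) → List (PVertex n)
prismVertices n = cartesianProduct (allFin n) (false ∷ true ∷ [])

IsUniformListAssignment : (n k : ℕ) → (PVertex n → List Color) → Set
IsUniformListAssignment n k L = ∀ x → Unique (L x) × length (L x) ≡ k

IsProperLColoring : (n : ℕ) → (PVertex n → List Color) → (PVertex n → Color) → Set
IsProperLColoring n L c =
  (∀ x → c x ∈ L x) × (∀ x y → PrismAdj n x y → c x ≢ c y)

colorClassSize : (n : ℕ) → (PVertex n → Color) → Color → ℕ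
colorClassSize n c col = length (filter (λ x → c x ≟ col) (prismVertices n))

ceilDiv : ℕ → (k : ℕ) → .{{NonZero k}} → ℕ
ceilDiv m (suc k) = (m + k) / suc k

EquitablyChoosablePrism : (n k : ℕ) → .{{NonZero k}} → Set
EquitablyChoosablePrism n k =
  ∀ (L : PVertex n → List Color) → IsUniformListAssignment n k L →
  Σ' (PVertex n → Color) λ c →
    IsProperLColoring n L c × (∀ col → colorClassSize n c col ≤ ceilDiv (2 * n) k)
  where
    open import Data.Product using () renaming (Σ to Σ')

-- Read the vertices column by column, u₀ v₀ u₁ v₁ …, and colour them greedily so that each vertex
-- avoids the two vertices just before it.  Such a strip is proper on the ladder and any three
-- consecutive entries are distinct, so on k columns every colour occurs at most ⌈2k/3⌉ times.  For
-- n ≥ 4 the strip fills all but three columns, and three closing columns are fitted between its two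
-- ends; to leave room for them, the first strip column is chosen together with a colour of its
-- neighbour in the closing columns.  On the six closing vertices every colour occurs at most twice,
-- and ⌈2(k+3)/3⌉ = ⌈2k/3⌉ + 2.  For n = 3 the prism is coloured directly, and there properness
-- alone keeps every colour to at most two vertices.
module Submission where

open import Defs
open import Data.Nat using (ℕ; zero; suc; _+_; _*_; _≤_; _<_; _≥_; z≤n; s≤s; pred)
open import Data.Nat.Properties
  using (_≟_; <⇒≱; ≤-refl; ≤-reflexive; +-mono-≤; +-identityʳ; +-assoc; *-distribˡ-+; module ≤-Reasoning)
open import Data.Nat.DivMod using (_/_; +-distrib-/; m%n<n)
open import Data.Bool using (Bool; true; false)
open import Data.Fin using (Fin; toℕ) renaming (zero to fzero; suc to fsuc)
open import Data.Fin.Properties using (toℕ<n)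
open import Data.Product using (Σ; ∃-syntax; _×_; _,_; proj₁; proj₂)
open import Data.Sum as Sum using (_⊎_; inj₁; inj₂)
open import Data.Empty using (⊥-elim)
open import Function using (_∘_; id)
open import Data.List using (List; []; _∷_; _++_; length; filter; map; tabulate; cartesianProduct)
open import Data.List.Properties
  using (length-removeAt′; length-++; filter-++; filter-accept; filter-reject; filter-none)
open import Data.List.Relation.Unary.Any using (here; there; index; _─_; any?)
open import Data.List.Relation.Unary.All as All using (All; []; _∷_)
open import Data.List.Relation.Unary.All.Properties using (¬Any⇒All¬)
open import Data.List.Relation.Unary.AllPairs using ([]; _∷_)
open import Data.List.Relation.Unary.Unique.Propositional using (Unique)
open import Data.List.Membership.Propositional using (_∈_; _∉_; find; lose)
open import Data.List.Membership.DecPropositional _≟_ using (_∈?_; _∉?_)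
open import Data.List.Relation.Binary.Subset.Propositional using (_⊆_)
open import Relation.Binary.PropositionalEquality
  using (_≡_; _≢_; refl; sym; trans; cong; cong₂; subst; ≢-sym; module ≡-Reasoning)
open import Relation.Nullary using (Dec; yes; no)
open import Relation.Nullary.Decidable using (decidable-stable)

module _ {A : Set} where

  ∉⇒≢ : ∀ {x y : A} {xs} → x ∉ xs → y ∈ xs → x ≢ y
  ∉⇒≢ x∉xs y∈xs x≡y = x∉xs (subst (_∈ _) (sym x≡y) y∈xs)

  ∈-─ : ∀ {x y : A} {ys} (x∈ys : x ∈ ys) → y ∈ ys → x ≢ y → y ∈ (ys ─ x∈ys)
  ∈-─ (here refl)  (here refl)  x≢y = ⊥-elim (x≢y refl)
  ∈-─ (here _)     (there y∈ys) _   = y∈ys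
  ∈-─ (there _)    (here refl)  _   = here refl
  ∈-─ (there x∈ys) (there y∈ys) x≢y = there (∈-─ x∈ys y∈ys x≢y)

  length-mono-⊆ : ∀ {xs ys : List A} → Unique xs → xs ⊆ ys → length xs ≤ length ys
  length-mono-⊆ [] _ = z≤n
  length-mono-⊆ {x ∷ xs} {ys} (x≢xs ∷ unique) x∷xs⊆ys = begin
    suc (length xs)          ≤⟨ s≤s (length-mono-⊆ unique xs⊆ys─x) ⟩
    suc (length (ys ─ x∈ys)) ≡⟨ sym (length-removeAt′ ys (index x∈ys)) ⟩
    length ys                ∎
    where
    open ≤-Reasoning
    x∈ys = x∷xs⊆ys (here refl)
    xs⊆ys─x : xs ⊆ (ys ─ x∈ys)
    xs⊆ys─x y∈xs = ∈-─ x∈ys (x∷xs⊆ys (there y∈xs)) (All.lookup x≢xs y∈xs)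

_⊈_ : List Color → List Color → Set
xs ⊈ ys = ∃[ x ] x ∈ xs × x ∉ ys

⊈-or-⊆ : ∀ xs ys → xs ⊈ ys ⊎ xs ⊆ ys
⊈-or-⊆ xs ys with any? (_∉? ys) xs
... | yes some∉ = inj₁ (find some∉)
... | no  none∉ = inj₂ λ {x} x∈xs → decidable-stable (x ∈? ys) (none∉ ∘ lose x∈xs)

⊈-longer : ∀ {xs ys} → Unique xs → length ys < length xs → xs ⊈ ys
⊈-longer {xs} {ys} unique longer with ⊈-or-⊆ xs ys
... | inj₁ xs⊈ys = xs⊈ys
... | inj₂ xs⊆ys = ⊥-elim (<⇒≱ longer (length-mono-⊆ unique xs⊆ys))

⊆⇒⊇ : ∀ {xs ys} → Unique xs → length ys ≤ length xs → xs ⊆ ys → ys ⊆ xs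
⊆⇒⊇ {xs} {ys} unique shorter xs⊆ys {y} y∈ys = decidable-stable (y ∈? xs) λ y∉xs →
  <⇒≱ (s≤s shorter) (length-mono-⊆ (¬Any⇒All¬ xs y∉xs ∷ unique) y∷xs⊆ys)
  where
  y∷xs⊆ys : (y ∷ xs) ⊆ ys
  y∷xs⊆ys (here refl)  = y∈ys
  y∷xs⊆ys (there x∈xs) = xs⊆ys x∈xs

Palette : ℕ → List Color → Set
Palette k xs = Unique xs × length xs ≡ k

palette-⊆⇒⊇ : ∀ {k xs ys} → Palette k xs → Palette k ys → xs ⊆ ys → ys ⊆ xs
palette-⊆⇒⊇ (unique , refl) (_ , |ys|≡|xs|) = ⊆⇒⊇ unique (≤-reflexive |ys|≡|xs|)

∃∈ : ∀ {k xs} → Palette (suc k) xs → ∃[ x ] x ∈ xs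
∃∈ {xs = x ∷ _} _ = x , here refl

module _ {xs : List Color} (palette : Palette 3 xs) (a b : Color) where

  private
    avoiding : xs ⊈ (a ∷ b ∷ [])
    avoiding = ⊈-longer (proj₁ palette) (subst (2 <_) (sym (proj₂ palette)) ≤-refl)

  pick : Color
  pick = proj₁ avoiding

  pick-∈ : pick ∈ xs
  pick-∈ = proj₁ (proj₂ avoiding)

  pick-≢ˡ : pick ≢ a
  pick-≢ˡ = proj₂ (proj₂ avoiding) ∘ here

  pick-≢ʳ : pick ≢ b
  pick-≢ʳ = proj₂ (proj₂ avoiding) ∘ there ∘ here

count : Color → List Color → ℕ
count col xs = length (filter (_≟ col) xs)

count-++ : ∀ col xs ys → count col (xs ++ ys) ≡ count col xs + count col ys
count-++ col xs ys = trans (cong length (filter-++ (_≟ col) xs ys)) (length-++ (filter (_≟ col) xs))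

count-++₃ : ∀ col xs ys zs → count col (xs ++ ys ++ zs) ≡ count col xs + (count col ys + count col zs)
count-++₃ col xs ys zs = trans (count-++ col xs (ys ++ zs)) (cong (count col xs +_) (count-++ col ys zs))

count-none : ∀ {col xs} → All (_≢ col) xs → count col xs ≡ 0
count-none {col} xs≢col = cong length (filter-none (_≟ col) xs≢col)

count-∷-≡ : ∀ {col x} xs → x ≡ col → count col (x ∷ xs) ≡ suc (count col xs)
count-∷-≡ {col} _ x≡col = cong length (filter-accept (_≟ col) x≡col)

count-∷-≢ : ∀ {col x} xs → x ≢ col → count col (x ∷ xs) ≡ count col xs
count-∷-≢ {col} _ x≢col = cong length (filter-reject (_≟ col) x≢col)

count-unique : ∀ col {xs} → Unique xs → count col xs ≤ 1
count-unique col [] = z≤n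
count-unique col {x ∷ xs} (x≢xs ∷ unique) with x ≟ col
... | yes refl  = subst (_≤ 1) (sym (trans (count-∷-≡ xs refl) (cong suc (count-none (All.map ≢-sym x≢xs))))) ≤-refl
... | no  x≢col = subst (_≤ 1) (sym (count-∷-≢ xs x≢col)) (count-unique col unique)

count-distinct₂ : ∀ {col x y} → x ≢ y → count col (x ∷ y ∷ []) ≤ 1
count-distinct₂ {col} x≢y = count-unique col ((x≢y ∷ []) ∷ [] ∷ [])

count-distinct₃ : ∀ {col x y z} → x ≢ y → x ≢ z → y ≢ z → count col (x ∷ y ∷ z ∷ []) ≤ 1
count-distinct₃ {col} x≢y x≢z y≢z = count-unique col ((x≢y ∷ x≢z ∷ []) ∷ (y≢z ∷ []) ∷ [] ∷ [])

count-map : ∀ {A : Set} (f : A → Color) col xs → length (filter (λ x → f x ≟ col) xs) ≡ count col (map f xs)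
count-map f col [] = refl
count-map f col (x ∷ xs) with f x ≟ col
... | yes fx≡col = trans (cong length (filter-accept (λ x → f x ≟ col) fx≡col))
                         (trans (cong suc (count-map f col xs)) (sym (count-∷-≡ (map f xs) fx≡col)))
... | no  fx≢col = trans (cong length (filter-reject (λ x → f x ≟ col) fx≢col))
                         (trans (count-map f col xs) (sym (count-∷-≢ (map f xs) fx≢col)))

sum₃≤2 : ∀ {a b c} → a ≤ 1 → b ≤ 1 → c ≤ 1 → a ≡ 0 ⊎ b ≡ 0 ⊎ c ≡ 0 → a + (b + c) ≤ 2
sum₃≤2         _   b≤1 c≤1 (inj₁ refl)        = +-mono-≤ b≤1 c≤1
sum₃≤2         a≤1 _   c≤1 (inj₂ (inj₁ refl)) = +-mono-≤ a≤1 c≤1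
sum₃≤2 {a} {b} a≤1 b≤1 _   (inj₂ (inj₂ refl)) = subst (λ k → a + k ≤ 2) (sym (+-identityʳ b)) (+-mono-≤ a≤1 b≤1)

ceilDiv-2*-3+ : ∀ n → ceilDiv (2 * (3 + n)) 3 ≡ 2 + ceilDiv (2 * n) 3
ceilDiv-2*-3+ n = begin
  (2 * (3 + n) + 2) / 3 ≡⟨ cong (_/ 3) (trans (cong (_+ 2) (*-distribˡ-+ 2 3 n)) (+-assoc 6 (2 * n) 2)) ⟩
  (6 + (2 * n + 2)) / 3 ≡⟨ +-distrib-/ 6 (2 * n + 2) (m%n<n (2 * n + 2) 3) ⟩
  2 + (2 * n + 2) / 3   ∎
  where open ≡-Reasoning

Column : Set
Column = Bool → Color

column : Color → Color → Column
column u v false = u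
column u v true  = v

columnColors : (ℕ → Column) → ℕ → List Color
columnColors g zero    = []
columnColors g (suc n) = g 0 false ∷ g 0 true ∷ columnColors (g ∘ suc) n

vertexColoring : ∀ {n} → (ℕ → Column) → PVertex n → Color
vertexColoring g (i , b) = g (toℕ i) b

map-cartesianProduct : ∀ {A : Set} {k} (f : Fin k → A) (χ : A × Bool → Color) (g : ℕ → Column) →
  (∀ i b → χ (f i , b) ≡ g (toℕ i) b) →
  map χ (cartesianProduct (tabulate f) (false ∷ true ∷ [])) ≡ columnColors g k
map-cartesianProduct {k = zero}  f χ g χ≡g = refl
map-cartesianProduct {k = suc k} f χ g χ≡g =
  cong₂ _∷_ (χ≡g fzero false) (cong₂ _∷_ (χ≡g fzero true)
    (map-cartesianProduct (f ∘ fsuc) χ (g ∘ suc) (χ≡g ∘ fsuc)))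

colorClassSize-columns : ∀ n g col → colorClassSize n (vertexColoring g) col ≡ count col (columnColors g n)
colorClassSize-columns n g col = trans (count-map (vertexColoring {n} g) col (prismVertices n))
  (cong (count col) (map-cartesianProduct id (vertexColoring {n} g) g λ _ _ → refl))

record IsProperColumnColoring (n : ℕ) (g : ℕ → Column) : Set where
  field
    rung : ∀ k → k < n → g k false ≢ g k true
    rail : ∀ k → suc k < n → ∀ b → g k b ≢ g (suc k) b
    wrap : ∀ b → g (pred n) b ≢ g 0 b

module _ {n g} (proper : IsProperColumnColoring n g) where
  open IsProperColumnColoring proper

  cycSucc-≢ : ∀ {i j} → CycSucc n i j → ∀ b → g (toℕ i) b ≢ g (toℕ j) b
  cycSucc-≢ {i} {j} (inj₁ j≡1+i) b rewrite j≡1+i = rail (toℕ i) (subst (_< n) j≡1+i (toℕ<n j)) b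
  cycSucc-≢ {i} {j} (inj₂ (1+i≡n , j≡0)) b rewrite j≡0 =
    subst (λ k → g k b ≢ g 0 b) (sym (cong pred 1+i≡n)) (wrap b)

  rung-≢ : ∀ (i : Fin n) {a b} → a ≢ b → g (toℕ i) a ≢ g (toℕ i) b
  rung-≢ i {false} {false} a≢b = ⊥-elim (a≢b refl)
  rung-≢ i {false} {true}  _   = rung (toℕ i) (toℕ<n i)
  rung-≢ i {true}  {false} _   = ≢-sym (rung (toℕ i) (toℕ<n i))
  rung-≢ i {true}  {true}  a≢b = ⊥-elim (a≢b refl)

  vertexColoring-proper : ∀ x y → PrismAdj n x y → vertexColoring g x ≢ vertexColoring g y
  vertexColoring-proper (i , a) (j , .a) (inj₁ (refl , inj₁ i→j)) = cycSucc-≢ i→j a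
  vertexColoring-proper (i , a) (j , .a) (inj₁ (refl , inj₂ j→i)) = ≢-sym (cycSucc-≢ j→i a)
  vertexColoring-proper (i , a) (.i , b) (inj₂ (refl , a≢b))      = rung-≢ i a≢b

record ColumnColoring (n : ℕ) (Λ : ℕ → Bool → List Color) : Set where
  field
    colors   : ℕ → Column
    colors-∈ : ∀ k b → k < n → colors k b ∈ Λ k b
    proper   : IsProperColumnColoring n colors
    balanced : ∀ col → count col (columnColors colors n) ≤ ceilDiv (2 * n) 3

-- A proper colouring of the ladder with the diagonals v_k u_{k+1} added; equivalently,
-- any three consecutive entries of u₀ v₀ u₁ v₁ u₂ … are distinct.
record IsStripColoring (g : ℕ → Column) : Set where
  field
    rung     : ∀ k → g k false ≢ g k true
    rail     : ∀ k b → g k b ≢ g (suc k) b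
    diagonal : ∀ k → g k true ≢ g (suc k) false

IsStripColoring-suc : ∀ {g} → IsStripColoring g → IsStripColoring (g ∘ suc)
IsStripColoring-suc S = record { rung = rung ∘ suc ; rail = rail ∘ suc ; diagonal = diagonal ∘ suc }
  where open IsStripColoring S

count-strip : ∀ {g} → IsStripColoring g → ∀ n col → count col (columnColors g n) ≤ ceilDiv (2 * n) 3
count-strip S zero       col = z≤n
count-strip S (suc zero) col = count-distinct₂ (IsStripColoring.rung S 0)
count-strip {g} S (suc (suc zero)) col =
  subst (_≤ 2) (sym (count-++ col (g 0 false ∷ g 0 true ∷ []) (g 1 false ∷ g 1 true ∷ [])))
    (+-mono-≤ (count-distinct₂ (rung 0)) (count-distinct₂ (rung 1)))
  where open IsStripColoring S
count-strip {g} S (suc (suc (suc n))) col = begin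
  count col (T₁ ++ T₂ ++ rest)                   ≡⟨ count-++₃ col T₁ T₂ rest ⟩
  count col T₁ + (count col T₂ + count col rest)
    ≤⟨ +-mono-≤ (count-distinct₃ (rung 0) (rail 0 false) (diagonal 0))
                (+-mono-≤ (count-distinct₃ (diagonal 1) (rail 1 true) (rung 2)) (count-strip S₃ n col)) ⟩
  2 + ceilDiv (2 * n) 3                          ≡⟨ sym (ceilDiv-2*-3+ n) ⟩
  ceilDiv (2 * (3 + n)) 3                        ∎
  where
  open ≤-Reasoning
  open IsStripColoring S
  T₁ = g 0 false ∷ g 0 true ∷ g 1 false ∷ []
  T₂ = g 1 true ∷ g 2 false ∷ g 2 true ∷ []
  rest = columnColors (λ k → g (3 + k)) n
  S₃ = IsStripColoring-suc (IsStripColoring-suc (IsStripColoring-suc S))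

module _ {Π : Bool → List Color} (palettes : ∀ b → Palette 3 (Π b)) (c : Column) where

  private
    u : Color
    u = pick (palettes false) (c false) (c true)

  nextColumn : Column
  nextColumn = column u (pick (palettes true) u (c true))

  nextColumn-∈ : ∀ b → nextColumn b ∈ Π b
  nextColumn-∈ false = pick-∈ (palettes false) (c false) (c true)
  nextColumn-∈ true  = pick-∈ (palettes true) u (c true)

  nextColumn-rung : nextColumn false ≢ nextColumn true
  nextColumn-rung = ≢-sym (pick-≢ˡ (palettes true) u (c true))

  nextColumn-rail : ∀ b → c b ≢ nextColumn b
  nextColumn-rail false = ≢-sym (pick-≢ˡ (palettes false) (c false) (c true))
  nextColumn-rail true  = ≢-sym (pick-≢ʳ (palettes true) u (c true))

  nextColumn-diagonal : c true ≢ nextColumn false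
  nextColumn-diagonal = ≢-sym (pick-≢ʳ (palettes false) (c false) (c true))

module _ {Λ : ℕ → Bool → List Color} (palettes : ∀ k b → Palette 3 (Λ k b)) where

  strip : Column → ℕ → Column
  strip c zero    = c
  strip c (suc k) = nextColumn (palettes (suc k)) (strip c k)

  strip-∈ : ∀ c k b → strip c (suc k) b ∈ Λ (suc k) b
  strip-∈ c k = nextColumn-∈ (palettes (suc k)) (strip c k)

  strip-isStripColoring : ∀ {c} → c false ≢ c true → IsStripColoring (strip c)
  strip-isStripColoring {c} c-rung = record { rung = rung ; rail = rail ; diagonal = diagonal }
    where
    rung : ∀ k → strip c k false ≢ strip c k true
    rung zero    = c-rung
    rung (suc k) = nextColumn-rung (palettes (suc k)) (strip c k)
    rail : ∀ k b → strip c k b ≢ strip c (suc k) b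
    rail k = nextColumn-rail (palettes (suc k)) (strip c k)
    diagonal : ∀ k → strip c k true ≢ strip c (suc k) false
    diagonal k = nextColumn-diagonal (palettes (suc k)) (strip c k)

misses-a-column : ∀ col {u₀ v₀ u₁ v₁ u₂ v₂} →
  u₀ ≢ u₁ → u₁ ≢ u₂ → u₀ ≢ u₂ → v₀ ≢ v₁ → v₁ ≢ v₂ → (v₀ ≡ u₁ → u₁ ≢ v₂) →
  All (_≢ col) (u₀ ∷ v₀ ∷ []) ⊎ All (_≢ col) (u₁ ∷ v₁ ∷ []) ⊎ All (_≢ col) (u₂ ∷ v₂ ∷ [])
misses-a-column col {u₀} {v₀} {u₁} {v₁} {u₂} {v₂} u₀≢u₁ u₁≢u₂ u₀≢u₂ v₀≢v₁ v₁≢v₂ cap with u₀ ≟ col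
... | yes refl with v₁ ≟ u₀
...   | yes refl   = inj₂ (inj₂ (≢-sym u₀≢u₂ ∷ ≢-sym v₁≢v₂ ∷ []))
...   | no  v₁≢col = inj₂ (inj₁ (≢-sym u₀≢u₁ ∷ v₁≢col ∷ []))
misses-a-column col {u₀} {v₀} {u₁} {v₁} {u₂} {v₂} u₀≢u₁ u₁≢u₂ u₀≢u₂ v₀≢v₁ v₁≢v₂ cap | no u₀≢col with v₀ ≟ col
...   | no  v₀≢col = inj₁ (u₀≢col ∷ v₀≢col ∷ [])
...   | yes refl with u₁ ≟ v₀
...     | no  u₁≢col = inj₂ (inj₁ (u₁≢col ∷ ≢-sym v₀≢v₁ ∷ []))
...     | yes refl   = inj₂ (inj₂ (≢-sym u₁≢u₂ ∷ ≢-sym (cap refl) ∷ []))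

-- The hypotheses leave {v₀, u₁, v₂} as the only triple of these vertices that could share a colour,
-- and the last one excludes it.
count-threeColumns : ∀ col {u₀ v₀ u₁ v₁ u₂ v₂} →
  u₀ ≢ v₀ → u₁ ≢ v₁ → u₂ ≢ v₂ →
  u₀ ≢ u₁ → u₁ ≢ u₂ → u₀ ≢ u₂ → v₀ ≢ v₁ → v₁ ≢ v₂ → (v₀ ≡ u₁ → u₁ ≢ v₂) →
  count col (u₀ ∷ v₀ ∷ u₁ ∷ v₁ ∷ u₂ ∷ v₂ ∷ []) ≤ 2
count-threeColumns col {u₀} {v₀} {u₁} {v₁} {u₂} {v₂} u₀≢v₀ u₁≢v₁ u₂≢v₂ u₀≢u₁ u₁≢u₂ u₀≢u₂ v₀≢v₁ v₁≢v₂ cap =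
  subst (_≤ 2) (sym (count-++₃ col (u₀ ∷ v₀ ∷ []) (u₁ ∷ v₁ ∷ []) (u₂ ∷ v₂ ∷ [])))
    (sum₃≤2 (count-distinct₂ u₀≢v₀) (count-distinct₂ u₁≢v₁) (count-distinct₂ u₂≢v₂)
      (Sum.map count-none (Sum.map count-none count-none)
        (misses-a-column col u₀≢u₁ u₁≢u₂ u₀≢u₂ v₀≢v₁ v₁≢v₂ cap)))

-- (A, B) is the first strip column and α the colour of the closing vertex next to A.  The closing
-- vertex next to B must avoid both B and α, but of these only X can lie in its palette.
record Anchor (Π Π′ : Bool → List Color) : Set where
  field
    A B α X  : Color
    A∈       : A ∈ Π false
    B∈       : B ∈ Π true
    A≢B      : A ≢ B
    α∈       : α ∈ Π′ false
    α≢A      : α ≢ A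
    X-covers : ∀ {c} → c ∈ Π′ true → c ≢ X → c ≢ B × c ≢ α

module _ {Π Π′ : Bool → List Color} (palettes : ∀ b → Palette 3 (Π b)) (palettes′ : ∀ b → Palette 3 (Π′ b)) where

  anchor : Anchor Π Π′
  anchor with ∃∈ (palettes true)
  ... | B , B∈ with B ∈? Π′ false | B ∈? Π′ true
  ...   | yes B∈Π′₀ | _ = record
    { A = A ; B = B ; α = B ; X = B
    ; A∈ = pick-∈ (palettes false) B B ; B∈ = B∈ ; A≢B = pick-≢ˡ (palettes false) B B
    ; α∈ = B∈Π′₀ ; α≢A = ≢-sym (pick-≢ˡ (palettes false) B B)
    ; X-covers = λ _ c≢B → c≢B , c≢B }
    where A = pick (palettes false) B B
  ...   | no _ | no B∉Π′₁ = record
    { A = A ; B = B ; α = α ; X = α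
    ; A∈ = pick-∈ (palettes false) B B ; B∈ = B∈ ; A≢B = pick-≢ˡ (palettes false) B B
    ; α∈ = pick-∈ (palettes′ false) A A ; α≢A = pick-≢ˡ (palettes′ false) A A
    ; X-covers = λ c∈ c≢α → ≢-sym (∉⇒≢ B∉Π′₁ c∈) , c≢α }
    where A = pick (palettes false) B B
          α = pick (palettes′ false) A A
  ...   | no B∉Π′₀ | yes B∈Π′₁ with ⊈-or-⊆ (Π′ false) (Π′ true)
  ...     | inj₂ Π′₀⊆Π′₁ = ⊥-elim (B∉Π′₀ (palette-⊆⇒⊇ (palettes′ false) (palettes′ true) Π′₀⊆Π′₁ B∈Π′₁))
  ...     | inj₁ (α , α∈ , α∉Π′₁) = record
    { A = A ; B = B ; α = α ; X = B
    ; A∈ = pick-∈ (palettes false) B α ; B∈ = B∈ ; A≢B = pick-≢ˡ (palettes false) B α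
    ; α∈ = α∈ ; α≢A = ≢-sym (pick-≢ʳ (palettes false) B α)
    ; X-covers = λ c∈ c≢B → c≢B , ≢-sym (∉⇒≢ α∉Π′₁ c∈) }
    where A = pick (palettes false) B α

-- Columns 0, 1, 2 close the cycle; columns 3, 4, … are the strip starting from the anchor column.
module LargePrism (m : ℕ) {Λ : ℕ → Bool → List Color} (palettes : ∀ k b → Palette 3 (Λ k b)) where
  open Anchor (anchor (palettes 3) (palettes 2))

  tail : ℕ → Column
  tail = strip (λ k → palettes (3 + k)) (column A B)

  tail-strip : IsStripColoring tail
  tail-strip = strip-isStripColoring (λ k → palettes (3 + k)) A≢B

  u₀ v₀ u₁ : Color
  u₀ = pick (palettes 0 false) (tail m false) α
  v₀ = pick (palettes 0 true) (tail m true) u₀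
  u₁ = pick (palettes 1 false) α u₀

  record VRow : Set where
    field
      v₁ v₂ : Color
      v₁∈   : v₁ ∈ Λ 1 true
      v₂∈   : v₂ ∈ Λ 2 true
      v₂≢X  : v₂ ≢ X
      u₁≢v₁ : u₁ ≢ v₁
      v₀≢v₁ : v₀ ≢ v₁
      v₁≢v₂ : v₁ ≢ v₂
      cap   : v₀ ≡ u₁ → u₁ ≢ v₂

  -- When v₀ = u₁, letting v₂ avoid v₀ rules out the triple {v₀, u₁, v₂} of count-threeColumns.
  vRow : Dec (v₀ ≡ u₁) → VRow
  vRow (yes v₀≡u₁) = record
    { v₁ = v₁ ; v₂ = v₂ ; v₁∈ = pick-∈ (palettes 1 true) v₀ v₂ ; v₂∈ = pick-∈ (palettes 2 true) X v₀
    ; v₂≢X = pick-≢ˡ (palettes 2 true) X v₀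
    ; u₁≢v₁ = λ u₁≡v₁ → pick-≢ˡ (palettes 1 true) v₀ v₂ (trans (sym u₁≡v₁) (sym v₀≡u₁))
    ; v₀≢v₁ = ≢-sym (pick-≢ˡ (palettes 1 true) v₀ v₂)
    ; v₁≢v₂ = pick-≢ʳ (palettes 1 true) v₀ v₂
    ; cap = λ _ → subst (_≢ v₂) v₀≡u₁ (≢-sym (pick-≢ʳ (palettes 2 true) X v₀)) }
    where v₂ = pick (palettes 2 true) X v₀
          v₁ = pick (palettes 1 true) v₀ v₂
  vRow (no v₀≢u₁) = record
    { v₁ = v₁ ; v₂ = v₂ ; v₁∈ = pick-∈ (palettes 1 true) u₁ v₀ ; v₂∈ = pick-∈ (palettes 2 true) X v₁
    ; v₂≢X = pick-≢ˡ (palettes 2 true) X v₁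
    ; u₁≢v₁ = ≢-sym (pick-≢ˡ (palettes 1 true) u₁ v₀)
    ; v₀≢v₁ = ≢-sym (pick-≢ʳ (palettes 1 true) u₁ v₀)
    ; v₁≢v₂ = ≢-sym (pick-≢ʳ (palettes 2 true) X v₁)
    ; cap = λ v₀≡u₁ → ⊥-elim (v₀≢u₁ v₀≡u₁) }
    where v₁ = pick (palettes 1 true) u₁ v₀
          v₂ = pick (palettes 2 true) X v₁

  open VRow (vRow (v₀ ≟ u₁))

  colors : ℕ → Column
  colors 0 = column u₀ v₀
  colors 1 = column u₁ v₁
  colors 2 = column α v₂
  colors (suc (suc (suc k))) = tail k

  u₀≢v₀ : u₀ ≢ v₀
  u₀≢v₀ = ≢-sym (pick-≢ʳ (palettes 0 true) (tail m true) u₀)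

  u₀≢u₁ : u₀ ≢ u₁
  u₀≢u₁ = ≢-sym (pick-≢ʳ (palettes 1 false) α u₀)

  u₁≢α : u₁ ≢ α
  u₁≢α = pick-≢ˡ (palettes 1 false) α u₀

  u₀≢α : u₀ ≢ α
  u₀≢α = pick-≢ʳ (palettes 0 false) (tail m false) α

  v₂≢B : v₂ ≢ B
  v₂≢B = proj₁ (X-covers v₂∈ v₂≢X)

  α≢v₂ : α ≢ v₂
  α≢v₂ = ≢-sym (proj₂ (X-covers v₂∈ v₂≢X))

  colors-∈ : ∀ k b → colors k b ∈ Λ k b
  colors-∈ 0 false = pick-∈ (palettes 0 false) (tail m false) α
  colors-∈ 0 true  = pick-∈ (palettes 0 true) (tail m true) u₀
  colors-∈ 1 false = pick-∈ (palettes 1 false) α u₀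
  colors-∈ 1 true  = v₁∈
  colors-∈ 2 false = α∈
  colors-∈ 2 true  = v₂∈
  colors-∈ 3 false = A∈
  colors-∈ 3 true  = B∈
  colors-∈ (suc (suc (suc (suc k)))) = strip-∈ (λ k → palettes (3 + k)) (column A B) k

  proper : IsProperColumnColoring (4 + m) colors
  proper = record { rung = rung ; rail = rail ; wrap = wrap }
    where
    open IsStripColoring tail-strip renaming (rung to tail-rung; rail to tail-rail)
    rung : ∀ k → k < 4 + m → colors k false ≢ colors k true
    rung 0 _ = u₀≢v₀
    rung 1 _ = u₁≢v₁
    rung 2 _ = α≢v₂
    rung (suc (suc (suc k))) _ = tail-rung k
    rail : ∀ k → suc k < 4 + m → ∀ b → colors k b ≢ colors (suc k) b
    rail 0 _ false = u₀≢u₁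
    rail 0 _ true  = v₀≢v₁
    rail 1 _ false = u₁≢α
    rail 1 _ true  = v₁≢v₂
    rail 2 _ false = α≢A
    rail 2 _ true  = v₂≢B
    rail (suc (suc (suc k))) _ = tail-rail k
    wrap : ∀ b → tail m b ≢ colors 0 b
    wrap false = ≢-sym (pick-≢ˡ (palettes 0 false) (tail m false) α)
    wrap true  = ≢-sym (pick-≢ˡ (palettes 0 true) (tail m true) u₀)

  balanced : ∀ col → count col (columnColors colors (4 + m)) ≤ ceilDiv (2 * (4 + m)) 3
  balanced col = begin
    count col (closing ++ columnColors tail (suc m))          ≡⟨ count-++ col closing _ ⟩
    count col closing + count col (columnColors tail (suc m))
      ≤⟨ +-mono-≤ (count-threeColumns col u₀≢v₀ u₁≢v₁ α≢v₂ u₀≢u₁ u₁≢α u₀≢α v₀≢v₁ v₁≢v₂ cap)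
                  (count-strip tail-strip (suc m) col) ⟩
    2 + ceilDiv (2 * suc m) 3                                 ≡⟨ sym (ceilDiv-2*-3+ (suc m)) ⟩
    ceilDiv (2 * (4 + m)) 3                                   ∎
    where
    open ≤-Reasoning
    closing = u₀ ∷ v₀ ∷ u₁ ∷ v₁ ∷ α ∷ v₂ ∷ []

  coloring : ColumnColoring (4 + m) Λ
  coloring = record { colors = colors ; colors-∈ = λ k b _ → colors-∈ k b ; proper = proper ; balanced = balanced }

module TriangularPrism {Λ : ℕ → Bool → List Color} (palettes : ∀ k b → Palette 3 (Λ k b)) where

  record Coloring : Set where
    field
      u₀ v₀ u₁ v₁ u₂ v₂ : Color
      u₀∈ : u₀ ∈ Λ 0 false
      v₀∈ : v₀ ∈ Λ 0 true
      u₁∈ : u₁ ∈ Λ 1 false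
      v₁∈ : v₁ ∈ Λ 1 true
      u₂∈ : u₂ ∈ Λ 2 false
      v₂∈ : v₂ ∈ Λ 2 true
      u₀≢v₀ : u₀ ≢ v₀
      u₁≢v₁ : u₁ ≢ v₁
      u₂≢v₂ : u₂ ≢ v₂
      u₀≢u₁ : u₀ ≢ u₁
      u₁≢u₂ : u₁ ≢ u₂
      u₂≢u₀ : u₂ ≢ u₀
      v₀≢v₁ : v₀ ≢ v₁
      v₁≢v₂ : v₁ ≢ v₂
      v₂≢v₀ : v₂ ≢ v₀

  private
    p₀ = palettes 0 false
    q₀ = palettes 0 true
    p₁ = palettes 1 false
    q₁ = palettes 1 true
    p₂ = palettes 2 false
    q₂ = palettes 2 true

  fresh-u₀ : ∀ {α} → α ∈ Λ 0 false → α ∉ Λ 1 false → Coloring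
  fresh-u₀ {α} α∈ α∉ = record
    { u₀ = α ; v₀ = v₀ ; u₁ = u₁ ; v₁ = v₁ ; u₂ = u₂ ; v₂ = v₂
    ; u₀∈ = α∈ ; v₀∈ = pick-∈ q₀ α α ; u₁∈ = pick-∈ p₁ u₂ v₁ ; v₁∈ = pick-∈ q₁ v₀ v₂
    ; u₂∈ = pick-∈ p₂ α v₂ ; v₂∈ = pick-∈ q₂ v₀ v₀
    ; u₀≢v₀ = ≢-sym (pick-≢ˡ q₀ α α) ; u₁≢v₁ = pick-≢ʳ p₁ u₂ v₁ ; u₂≢v₂ = pick-≢ʳ p₂ α v₂
    ; u₀≢u₁ = ∉⇒≢ α∉ (pick-∈ p₁ u₂ v₁) ; u₁≢u₂ = pick-≢ˡ p₁ u₂ v₁ ; u₂≢u₀ = pick-≢ˡ p₂ α v₂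
    ; v₀≢v₁ = ≢-sym (pick-≢ˡ q₁ v₀ v₂) ; v₁≢v₂ = pick-≢ʳ q₁ v₀ v₂ ; v₂≢v₀ = pick-≢ˡ q₂ v₀ v₀ }
    where v₀ = pick q₀ α α
          v₂ = pick q₂ v₀ v₀
          u₂ = pick p₂ α v₂
          v₁ = pick q₁ v₀ v₂
          u₁ = pick p₁ u₂ v₁

  fresh-v₁ : ∀ {α} → α ∈ Λ 1 true → α ∉ Λ 1 false → Coloring
  fresh-v₁ {α} α∈ α∉ = record
    { u₀ = u₀ ; v₀ = v₀ ; u₁ = u₁ ; v₁ = α ; u₂ = u₂ ; v₂ = v₂
    ; u₀∈ = pick-∈ p₀ u₂ v₀ ; v₀∈ = pick-∈ q₀ α v₂ ; u₁∈ = pick-∈ p₁ u₀ u₂ ; v₁∈ = α∈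
    ; u₂∈ = pick-∈ p₂ v₂ v₂ ; v₂∈ = pick-∈ q₂ α α
    ; u₀≢v₀ = pick-≢ʳ p₀ u₂ v₀ ; u₁≢v₁ = ≢-sym (∉⇒≢ α∉ (pick-∈ p₁ u₀ u₂)) ; u₂≢v₂ = pick-≢ˡ p₂ v₂ v₂
    ; u₀≢u₁ = ≢-sym (pick-≢ˡ p₁ u₀ u₂) ; u₁≢u₂ = pick-≢ʳ p₁ u₀ u₂ ; u₂≢u₀ = ≢-sym (pick-≢ˡ p₀ u₂ v₀)
    ; v₀≢v₁ = pick-≢ˡ q₀ α v₂ ; v₁≢v₂ = ≢-sym (pick-≢ˡ q₂ α α) ; v₂≢v₀ = ≢-sym (pick-≢ʳ q₀ α v₂) }
    where v₂ = pick q₂ α α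
          v₀ = pick q₀ α v₂
          u₂ = pick p₂ v₂ v₂
          u₀ = pick p₀ u₂ v₀
          u₁ = pick p₁ u₀ u₂

  shared : ∀ {α} → α ∈ Λ 0 false → α ∈ Λ 1 true → Coloring
  shared {α} α∈₀ α∈₁ = record
    { u₀ = α ; v₀ = v₀ ; u₁ = u₁ ; v₁ = α ; u₂ = u₂ ; v₂ = v₂
    ; u₀∈ = α∈₀ ; v₀∈ = pick-∈ q₀ α v₂ ; u₁∈ = pick-∈ p₁ α u₂ ; v₁∈ = α∈₁
    ; u₂∈ = pick-∈ p₂ α α ; v₂∈ = pick-∈ q₂ α u₂
    ; u₀≢v₀ = ≢-sym (pick-≢ˡ q₀ α v₂) ; u₁≢v₁ = pick-≢ˡ p₁ α u₂ ; u₂≢v₂ = ≢-sym (pick-≢ʳ q₂ α u₂)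
    ; u₀≢u₁ = ≢-sym (pick-≢ˡ p₁ α u₂) ; u₁≢u₂ = pick-≢ʳ p₁ α u₂ ; u₂≢u₀ = pick-≢ˡ p₂ α α
    ; v₀≢v₁ = pick-≢ˡ q₀ α v₂ ; v₁≢v₂ = ≢-sym (pick-≢ˡ q₂ α u₂) ; v₂≢v₀ = ≢-sym (pick-≢ʳ q₀ α v₂) }
    where u₂ = pick p₂ α α
          v₂ = pick q₂ α u₂
          u₁ = pick p₁ α u₂
          v₀ = pick q₀ α v₂

  -- Π₃ is 3-regular, so greedy colouring succeeds once one constraint comes for free: u₀ or v₁ takes
  -- a colour that their common neighbour u₁ cannot use, or else all three lists agree as sets and the
  -- non-adjacent u₀ and v₁ share a colour.
  triangular : Coloring
  triangular with ⊈-or-⊆ (Λ 0 false) (Λ 1 false)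
  ... | inj₁ (α , α∈ , α∉) = fresh-u₀ α∈ α∉
  ... | inj₂ P₀⊆P₁ with ⊈-or-⊆ (Λ 1 true) (Λ 1 false)
  ...   | inj₁ (α , α∈ , α∉) = fresh-v₁ α∈ α∉
  ...   | inj₂ Q₁⊆P₁ = shared α∈ (palette-⊆⇒⊇ q₁ p₁ Q₁⊆P₁ (P₀⊆P₁ α∈))
    where α∈ = proj₂ (∃∈ p₀)

  coloring : ColumnColoring 3 Λ
  coloring = record { colors = colors ; colors-∈ = colors-∈ ; proper = proper ; balanced = balanced }
    where
    open Coloring triangular
    colors : ℕ → Column
    colors 0 = column u₀ v₀
    colors 1 = column u₁ v₁
    colors _ = column u₂ v₂
    colors-∈ : ∀ k b → k < 3 → colors k b ∈ Λ k b
    colors-∈ 0 false _ = u₀∈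
    colors-∈ 0 true  _ = v₀∈
    colors-∈ 1 false _ = u₁∈
    colors-∈ 1 true  _ = v₁∈
    colors-∈ 2 false _ = u₂∈
    colors-∈ 2 true  _ = v₂∈
    colors-∈ (suc (suc (suc k))) _ (s≤s (s≤s (s≤s ())))
    proper : IsProperColumnColoring 3 colors
    proper = record { rung = rung ; rail = rail ; wrap = wrap }
      where
      rung : ∀ k → k < 3 → colors k false ≢ colors k true
      rung 0 _ = u₀≢v₀
      rung 1 _ = u₁≢v₁
      rung 2 _ = u₂≢v₂
      rung (suc (suc (suc k))) (s≤s (s≤s (s≤s ())))
      rail : ∀ k → suc k < 3 → ∀ b → colors k b ≢ colors (suc k) b
      rail 0 _ false = u₀≢u₁
      rail 0 _ true  = v₀≢v₁
      rail 1 _ false = u₁≢u₂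
      rail 1 _ true  = v₁≢v₂
      rail (suc (suc k)) (s≤s (s≤s (s≤s ())))
      wrap : ∀ b → colors 2 b ≢ colors 0 b
      wrap false = u₂≢u₀
      wrap true  = v₂≢v₀
    balanced : ∀ col → count col (columnColors colors 3) ≤ 2
    balanced col = count-threeColumns col u₀≢v₀ u₁≢v₁ u₂≢v₂ u₀≢u₁ u₁≢u₂ (≢-sym u₂≢u₀) v₀≢v₁ v₁≢v₂
      λ v₀≡u₁ u₁≡v₂ → v₂≢v₀ (sym (trans v₀≡u₁ u₁≡v₂))

columnColoring : ∀ n → n ≥ 3 → ∀ {Λ} → (∀ k b → Palette 3 (Λ k b)) → ColumnColoring n Λ
columnColoring 3                         _ palettes = TriangularPrism.coloring palettes
columnColoring (suc (suc (suc (suc m)))) _ palettes = LargePrism.coloring m palettes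
columnColoring 0 ()              _
columnColoring 1 (s≤s ())        _
columnColoring 2 (s≤s (s≤s ()))  _

extend : ∀ {A : Set} {n} → (Fin n → A) → A → ℕ → A
extend {n = zero}  f d k       = d
extend {n = suc n} f d zero    = f fzero
extend {n = suc n} f d (suc k) = extend (f ∘ fsuc) d k

extend-toℕ : ∀ {A : Set} {n} (f : Fin n → A) d i → extend f d (toℕ i) ≡ f i
extend-toℕ f d fzero    = refl
extend-toℕ f d (fsuc i) = extend-toℕ (f ∘ fsuc) d i

extend-all : ∀ {A : Set} (P : A → Set) {n} {f : Fin n → A} {d} → (∀ i → P (f i)) → P d → ∀ k → P (extend f d k)
extend-all P {zero}  Pf Pd k       = Pd
extend-all P {suc n} Pf Pd zero    = Pf fzero
extend-all P {suc n} Pf Pd (suc k) = extend-all P (Pf ∘ fsuc) Pd k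

-- Beyond column n the palettes are padded with an arbitrary 3-palette, so that strips are defined on all of ℕ.
columnPalettes : ∀ {n} → (PVertex n → List Color) → ℕ → Bool → List Color
columnPalettes L = extend (λ i b → L (i , b)) (λ _ → 0 ∷ 1 ∷ 2 ∷ [])

columnPalettes-palette : ∀ {n L} → IsUniformListAssignment n 3 L → ∀ k b → Palette 3 (columnPalettes L k b)
columnPalettes-palette {L = L} uniform =
  extend-all (λ Π → ∀ b → Palette 3 (Π b)) {f = λ i b → L (i , b)} (λ i b → uniform (i , b)) λ _ → 0-1-2
  where
  0-1-2 : Palette 3 (0 ∷ 1 ∷ 2 ∷ [])
  0-1-2 = ((λ ()) ∷ (λ ()) ∷ []) ∷ ((λ ()) ∷ []) ∷ [] ∷ [] , refl

prismColoring : ∀ {n L} → ColumnColoring n (columnPalettes L) →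
  Σ (PVertex n → Color) λ c → IsProperLColoring n L c × (∀ col → colorClassSize n c col ≤ ceilDiv (2 * n) 3)
prismColoring {n} {L} C = vertexColoring colors , (colors-∈L , vertexColoring-proper proper) , classSize≤
  where
  open ColumnColoring C
  colors-∈L : ∀ x → vertexColoring colors x ∈ L x
  colors-∈L (i , b) =
    subst (λ Π → colors (toℕ i) b ∈ Π b) (extend-toℕ (λ i b → L (i , b)) _ i) (colors-∈ (toℕ i) b (toℕ<n i))
  classSize≤ : ∀ col → colorClassSize n (vertexColoring colors) col ≤ ceilDiv (2 * n) 3
  classSize≤ col = subst (_≤ ceilDiv (2 * n) 3) (sym (colorClassSize-columns n colors col)) (balanced col)

theorem1p6 : (n : ℕ) → n ≥ 3 → EquitablyChoosablePrism n 3
theorem1p6 n n≥3 L uniform = prismColoring (columnColoring n n≥3 (columnPalettes-palette uniform))
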